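{- Let $s,t,k,m$ be nonnegative integers. There is a bijection $\varphi$ between the set of pairs of partitions $(\alpha,\beta)$, where $\alpha$ has $s$ distinct parts with each part $\ge m$ and $\beta$ has $t$ parts with each part $\ge k+s+t-1$, and the set of pairs of partitions $(\mu,\nu)$ satisfying the following: if $s,t>0$, then $\mu$ has $s+t$ distinct nonnegative parts with $\mu_s-\mu_{s+1}\ge m+1$ and $\nu$ has $t$ distinct parts with $k\le \nu_i\le k+s+t-1$ for each $1\le i\le t$; if $s>0$ and $t=0$, then $\mu=\alpha$ and $\nu$ is the empty partition; if $s=0$ and $t>0$, then $\mu=(\beta_1-k,\beta_2-k-1,\ldots,\beta_t-k-t+1)$ and $\nu=(k+t-1,k+t-2,\ldots,k)$; if $s=t=0$, then both $\mu$ and $\nu$ are empty partitions. Moreover, the bijection satisfies $|\alpha|+|\beta|=|\mu|+|\nu|$.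
   Context: A partition $\lambda=(\lambda_1,\ldots,\lambda_r)$ has $\lambda_1\ge\lambda_2\ge\cdots\ge\lambda_r\ge 0$; $l(\lambda)$ is its number of parts and $|\lambda|$ the sum of its parts. This is a variation of Zeilberger's Algorithm Z (insertion of the parts of one partition into another, with a record partition keeping track of insertion positions); $\mu$ is called the insertion partition and $\nu$ the record partition. -}

module Defs where

open import Data.Nat using (ℕ; zero; suc; _+_; _∸_; _≤_; _<_; _≥_; _>_)
open import Data.List using (List; []; _∷_; length; drop)
open import Data.Nat.ListAction using (sum)
open import Data.Unit using (⊤)
open import Data.List.Relation.Unary.All using (All)
open import Data.List.Relation.Unary.Linked using (Linked)
open import Data.Product using (_×_; _,_; ∃-syntax; proj₁; proj₂)
open import Relation.Binary.PropositionalEquality using (_≡_)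

-- A partition: a weakly decreasing list of nonnegative integers
-- (zero parts allowed, as in the paper's convention λ_r ≥ 0).
-- Its number of parts l(λ) is 'length', its size |λ| is 'sum'.
Partition : List ℕ → Set
Partition xs = Linked _≥_ xs

DistinctPartition : List ℕ → Set
DistinctPartition xs = Linked _>_ xs

Pair : Set
Pair = List ℕ × List ℕ

InA : (s t k m : ℕ) → Pair → Set
InA s t k m (α , β) =
  DistinctPartition α × length α ≡ s × All (m ≤_) α ×
  Partition β × length β ≡ t × All (((k + s + t) ∸ 1) ≤_) β

-- μ_s - μ_{s+1} ≥ m+1  (1-based indices; used only when s ≥ 1, l(μ) = s+t ≥ s+1)
GapAt : (s m : ℕ) → List ℕ → Set
GapAt s m μ = ∃[ x ] ∃[ y ] ∃[ rest ] (drop (s ∸ 1) μ ≡ x ∷ y ∷ rest × y + (m + 1) ≤ x)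

stair : ℕ → ℕ → List ℕ
stair k zero = []
stair k (suc t) = (k + t) ∷ stair k t

shiftDownFrom : ℕ → ℕ → List ℕ → List ℕ
shiftDownFrom k i [] = []
shiftDownFrom k i (b ∷ bs) = (b ∸ (k + i)) ∷ shiftDownFrom k (suc i) bs

shiftDown : ℕ → List ℕ → List ℕ
shiftDown k β = shiftDownFrom k 0 β

InB : (s t k m : ℕ) → Pair → Set
InB zero zero k m (μ , ν) = μ ≡ [] × ν ≡ []
InB (suc s') zero k m (μ , ν) =
  DistinctPartition μ × length μ ≡ suc s' × All (m ≤_) μ × ν ≡ []
InB zero (suc t') k m (μ , ν) =
  DistinctPartition μ × length μ ≡ suc t' × ν ≡ stair k (suc t')
InB (suc s') (suc t') k m (μ , ν) =
  DistinctPartition μ × length μ ≡ suc s' + suc t' × GapAt (suc s') m μ ×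
  DistinctPartition ν × length ν ≡ suc t' ×
  All (λ v → k ≤ v × v ≤ (k + suc s' + suc t') ∸ 1) ν

-- The explicitly prescribed values of φ in the degenerate cases.
Prescribed : (s t k : ℕ) → Pair → Pair → Set
Prescribed zero zero k (α , β) (μ , ν) = μ ≡ [] × ν ≡ []
Prescribed (suc s') zero k (α , β) (μ , ν) = μ ≡ α × ν ≡ []
Prescribed zero (suc t') k (α , β) (μ , ν) = μ ≡ shiftDown k β × ν ≡ stair k (suc t')
Prescribed (suc s') (suc t') k _ _ = ⊤

size : Pair → ℕ
size (x , y) = sum x + sum y

-- Let K = k + s + t − 1. A partition β into t parts ≥ K is the same as its t gaps
-- β_i − β_{i+1} and β_t − K, which are arbitrary; likewise a partition L into t distinct
-- parts is given by t arbitrary gaps. The record ν is kept as a word of s + t letters whose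
-- trues mark its parts. Starting from s falses, the gaps d of β are fed one by one into a
-- step of Algorithm Z, which adds a true to the word and emits a gap g of L; the step can
-- be undone from its output, and μ is α lifted just above L, followed by L. A step turns
-- (1 + #trues) d into the inversions it creates plus (1 + length) g, and summing these
-- identities gives |α| + |β| = |μ| + |ν|. For s = 0, μ is β minus a staircase.

module Submission where

open import Defs
open import Data.Bool using (Bool; true; false)
open import Data.Empty using (⊥-elim)
open import Data.List using (List; []; _∷_; length; drop; take; _++_; map; replicate)
open import Data.List.Properties
  using ( length-++; length-++-≤ˡ; length-++-sucʳ; length-++-comm; length-map; length-take; length-drop; length-replicate
        ; drop-[]; take++drop≡id; map-∘; map-cong; map-id; map-id-local)
open import Data.Nat
open import Data.Nat.DivMod
open import Data.Nat.ListAction using (sum)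
open import Data.Nat.ListAction.Properties using (sum-++)
open import Data.Nat.Properties
open import Data.Nat.Tactic.RingSolver using (solve-∀)
open import Data.List.Relation.Unary.All using (All; []; _∷_)
import Data.List.Relation.Unary.All as All
open import Data.List.Relation.Unary.All.Properties using (map⁺)
open import Data.List.Relation.Unary.Linked using (Linked; []; [-]; _∷_)
import Data.List.Relation.Unary.Linked as Linked
open import Data.List.Relation.Unary.Linked.Properties using (Linked⇒All)
open import Data.Product using (Σ; _×_; _,_; proj₁; proj₂; uncurry)
open import Data.Unit using (tt)
open import Relation.Nullary using (yes; no)
open import Relation.Binary.PropositionalEquality

take-length-++ : ∀ {A : Set} (u v : List A) → take (length u) (u ++ v) ≡ u
take-length-++ [] v = refl
take-length-++ (x ∷ u) v = cong (x ∷_) (take-length-++ u v)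

drop-length-++ : ∀ {A : Set} (u v : List A) → drop (length u) (u ++ v) ≡ v
drop-length-++ [] v = refl
drop-length-++ (x ∷ u) v = drop-length-++ u v

drop-suc : ∀ n (xs : List ℕ) {x r} → drop n xs ≡ x ∷ r → drop (suc n) xs ≡ r
drop-suc zero (x ∷ xs) refl = refl
drop-suc (suc n) (_ ∷ xs) eq = drop-suc n xs eq

linked-take : ∀ {R : ℕ → ℕ → Set} n {xs} → Linked R xs → Linked R (take n xs)
linked-take zero _ = []
linked-take (suc n) [] = []
linked-take (suc zero) [-] = [-]
linked-take (suc (suc n)) [-] = [-]
linked-take (suc zero) (_ ∷ _) = [-]
linked-take (suc (suc n)) (r ∷ linked) = r ∷ linked-take (suc n) linked

linked-drop : ∀ {R : ℕ → ℕ → Set} n {xs} → Linked R xs → Linked R (drop n xs)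
linked-drop zero linked = linked
linked-drop (suc n) {[]} linked = linked
linked-drop (suc n) {_ ∷ _} linked = linked-drop n (Linked.tail linked)

distinct⇒<head : ∀ {x xs} → Linked _>_ (x ∷ xs) → All (_< x) xs
distinct⇒<head [-] = []
distinct⇒<head (y<x ∷ distinct) = Linked⇒All (λ y<x z<y → <-trans z<y y<x) y<x distinct

distinct-∷ : ∀ {x xs} → All (_< x) xs → Linked _>_ xs → Linked _>_ (x ∷ xs)
distinct-∷ [] [] = [-]
distinct-∷ (y<x ∷ _) distinct = y<x ∷ distinct

take-suc-≥ : ∀ n μ {x r} → Linked _>_ μ → drop n μ ≡ x ∷ r → All (x ≤_) (take (suc n) μ)
take-suc-≥ zero (x ∷ μ) _ refl = ≤-refl ∷ []
take-suc-≥ (suc n) (z ∷ []) _ eq with trans (sym (drop-[] n)) eq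
... | ()
take-suc-≥ (suc n) (z ∷ y ∷ μ) (y<z ∷ distinct) eq with take-suc-≥ n (y ∷ μ) distinct eq
... | x≤y ∷ x≤rest = ≤-trans x≤y (<⇒≤ y<z) ∷ x≤y ∷ x≤rest

map-∸-distinct : ∀ b {xs} → Linked _>_ xs → All (b ≤_) xs → Linked _>_ (map (_∸ b) xs)
map-∸-distinct b [] _ = []
map-∸-distinct b [-] _ = [-]
map-∸-distinct b (y<x ∷ distinct) (_ ∷ b≤rest@(b≤y ∷ _)) =
  ∸-monoˡ-< y<x b≤y ∷ map-∸-distinct b distinct b≤rest

sum-map-+ : ∀ b xs → sum (map (_+ b) xs) ≡ sum xs + length xs * b
sum-map-+ b [] = refl
sum-map-+ b (x ∷ xs) rewrite sum-map-+ b xs = rearrange x b (sum xs) (length xs)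
  where
  rearrange : ∀ x b s n → x + b + (s + n * b) ≡ x + s + (b + n * b)
  rearrange = solve-∀

[r+q*n]%n≡r : ∀ r q n → r ≤ n → (r + q * suc n) % suc n ≡ r
[r+q*n]%n≡r r q n r≤n = trans ([m+kn]%n≡m%n r q (suc n)) (m≤n⇒m%n≡m r≤n)

[r+q*n]/n≡q : ∀ r q n → r ≤ n → (r + q * suc n) / suc n ≡ q
[r+q*n]/n≡q r q n r≤n = sym (*-cancelʳ-≡ q _ (suc n) (+-cancelˡ-≡ r _ _ divMod))
  where
  divMod : r + q * suc n ≡ r + ((r + q * suc n) / suc n) * suc n
  divMod = trans (m≡m%n+[m/n]*n (r + q * suc n) (suc n))
                 (cong (_+ ((r + q * suc n) / suc n) * suc n) ([r+q*n]%n≡r r q n r≤n))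

m∸n+n∸o≡m∸o : ∀ {m n o} → o ≤ n → n ≤ m → m ∸ n + (n ∸ o) ≡ m ∸ o
m∸n+n∸o≡m∸o {m} {n} {o} o≤n n≤m = trans (sym (+-∸-assoc (m ∸ n) o≤n)) (cong (_∸ o) (m∸n+n≡m n≤m))

triangular : ℕ → ℕ
triangular zero = 0
triangular (suc n) = n + triangular n

2*triangular : ∀ n → 2 * triangular (suc n) ≡ suc n * n
2*triangular zero = refl
2*triangular (suc n) = begin
  2 * (suc n + triangular (suc n))   ≡⟨ *-distribˡ-+ 2 (suc n) (triangular (suc n)) ⟩
  2 * suc n + 2 * triangular (suc n) ≡⟨ cong (2 * suc n +_) (2*triangular n) ⟩
  2 * suc n + suc n * n              ≡⟨ rearrange n ⟩
  suc (suc n) * suc n                ∎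
  where
  open ≡-Reasoning
  rearrange : ∀ n → 2 * suc n + suc n * n ≡ suc (suc n) * suc n
  rearrange = solve-∀

t*[k+s+t∸1]≡t*k+t*s+2T : ∀ k s t → t * (k + s + t ∸ 1) ≡ t * k + t * s + 2 * triangular t
t*[k+s+t∸1]≡t*k+t*s+2T k s zero = refl
t*[k+s+t∸1]≡t*k+t*s+2T k s (suc t) rewrite +-suc (k + s) t | 2*triangular t = rearrange k s t
  where
  rearrange : ∀ k s t → suc t * (k + s + t) ≡ suc t * k + suc t * s + suc t * t
  rearrange = solve-∀

weightedSum : ℕ → List ℕ → ℕ
weightedSum a [] = 0
weightedSum a (x ∷ xs) = a * x + weightedSum (suc a) xs

weightedSum-+ : ∀ a b xs → weightedSum (a + b) xs ≡ weightedSum a xs + b * sum xs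
weightedSum-+ a b [] = sym (*-zeroʳ b)
weightedSum-+ a b (x ∷ xs) rewrite weightedSum-+ (suc a) b xs =
  rearrange a b x (weightedSum (suc a) xs) (sum xs)
  where
  rearrange : ∀ a b x w s → (a + b) * x + (w + b * s) ≡ a * x + w + b * (x + s)
  rearrange = solve-∀

-- Words over Bool and their inversions

trues : List Bool → ℕ
trues [] = 0
trues (true ∷ w) = suc (trues w)
trues (false ∷ w) = trues w

falses : List Bool → ℕ
falses [] = 0
falses (true ∷ w) = falses w
falses (false ∷ w) = suc (falses w)

inversions : List Bool → ℕ
inversions [] = 0
inversions (true ∷ w) = falses w + inversions w
inversions (false ∷ w) = inversions w

length≡trues+falses : ∀ w → length w ≡ trues w + falses w
length≡trues+falses [] = refl
length≡trues+falses (true ∷ w) = cong suc (length≡trues+falses w)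
length≡trues+falses (false ∷ w) = trans (cong suc (length≡trues+falses w)) (sym (+-suc _ _))

trues-++ : ∀ u v → trues (u ++ v) ≡ trues u + trues v
trues-++ [] v = refl
trues-++ (true ∷ u) v = cong suc (trues-++ u v)
trues-++ (false ∷ u) v = trues-++ u v

falses-++ : ∀ u v → falses (u ++ v) ≡ falses u + falses v
falses-++ [] v = refl
falses-++ (true ∷ u) v = falses-++ u v
falses-++ (false ∷ u) v = cong suc (falses-++ u v)

inversions-++ : ∀ u v → inversions (u ++ v) ≡ inversions u + trues u * falses v + inversions v
inversions-++ [] v = refl
inversions-++ (false ∷ u) v = inversions-++ u v
inversions-++ (true ∷ u) v
  rewrite falses-++ u v | inversions-++ u v =
    rearrange (falses u) (falses v) (inversions u) (inversions v) (trues u)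
  where
  rearrange : ∀ a b c d e → a + b + (c + e * b + d) ≡ a + c + (b + e * b) + d
  rearrange = solve-∀

trues-replicate : ∀ n → trues (replicate n false) ≡ 0
trues-replicate zero = refl
trues-replicate (suc n) = trues-replicate n

inversions-replicate : ∀ n → inversions (replicate n false) ≡ 0
inversions-replicate zero = refl
inversions-replicate (suc n) = inversions-replicate n

trues≡0⇒replicate : ∀ w → trues w ≡ 0 → w ≡ replicate (length w) false
trues≡0⇒replicate [] _ = refl
trues≡0⇒replicate (false ∷ w) tw≡0 = cong (false ∷_) (trues≡0⇒replicate w tw≡0)

-- The insertion step and its inverse

splitAtTrue : ℕ → List Bool → List Bool × List Bool
splitAtTrue a [] = [] , []
splitAtTrue a (false ∷ w) = let (u , v) = splitAtTrue a w in false ∷ u , v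
splitAtTrue zero (true ∷ w) = [] , w
splitAtTrue (suc a) (true ∷ w) = let (u , v) = splitAtTrue a w in true ∷ u , v

splitAtTrue-++ : ∀ u v → splitAtTrue (trues u) (u ++ true ∷ v) ≡ (u , v)
splitAtTrue-++ [] v = refl
splitAtTrue-++ (false ∷ u) v rewrite splitAtTrue-++ u v = refl
splitAtTrue-++ (true ∷ u) v rewrite splitAtTrue-++ u v = refl

splitAtTrue-correct : ∀ a w → a < trues w →
  let (u , v) = splitAtTrue a w in w ≡ u ++ true ∷ v × trues u ≡ a
splitAtTrue-correct a (false ∷ w) a<t =
  let (w≡ , tu≡a) = splitAtTrue-correct a w a<t in cong (false ∷_) w≡ , tu≡a
splitAtTrue-correct zero (true ∷ w) _ = refl , refl
splitAtTrue-correct (suc a) (true ∷ w) (s≤s a<t) =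
  let (w≡ , tu≡a) = splitAtTrue-correct a w a<t in cong (true ∷_) w≡ , cong suc tu≡a

-- One step of Algorithm Z: with d = r + q (1 + length w) and r ≤ length w, the first r
-- letters of w are moved behind a new true, and the emitted g counts the trues moved
-- plus q (1 + trues w).
insert : List Bool → ℕ → List Bool × ℕ
insert w d = drop r w ++ true ∷ take r w , trues (take r w) + q * suc (trues w)
  where
  r = d % suc (length w)
  q = d / suc (length w)

-- With 1 + c trues in w, the true followed by exactly g % (1 + c) trues is deleted and
-- the letters after it are moved back to the front.
remove : List Bool → ℕ → List Bool × ℕ
remove w g = u ++ v , length u + q * suc (length (u ++ v))
  where
  c = pred (trues w)
  q = g / suc c
  v = proj₁ (splitAtTrue (c ∸ g % suc c) w)
  u = proj₂ (splitAtTrue (c ∸ g % suc c) w)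

data InsertView : List Bool → ℕ → Set where
  cut : ∀ u v q → InsertView (u ++ v) (length u + q * suc (length (u ++ v)))

data RemoveView : List Bool → ℕ → Set where
  cut : ∀ v u q → RemoveView (v ++ true ∷ u) (trues u + q * suc (trues v + trues u))

insertView : ∀ w d → InsertView w d
insertView w d = subst₂ InsertView (take++drop≡id r w) d≡ (cut (take r w) (drop r w) q)
  where
  r = d % suc (length w)
  q = d / suc (length w)
  r≤n : r ≤ length w
  r≤n = ≤-pred (m%n<n d (suc (length w)))
  d≡ : length (take r w) + q * suc (length (take r w ++ drop r w)) ≡ d
  d≡ = trans (cong₂ (λ a x → a + q * suc (length x))
                    (trans (length-take r w) (m≤n⇒m⊓n≡m r≤n)) (take++drop≡id r w))
             (sym (m≡m%n+[m/n]*n d (suc (length w))))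

removeView : ∀ c w g → trues w ≡ suc c → RemoveView w g
removeView c w g tw≡ = subst₂ RemoveView (sym w≡) g≡ (cut v u q)
  where
  i = g % suc c
  q = g / suc c
  i≤c : i ≤ c
  i≤c = ≤-pred (m%n<n g (suc c))
  split = splitAtTrue-correct (c ∸ i) w (subst (c ∸ i <_) (sym tw≡) (s≤s (m∸n≤m c i)))
  v = proj₁ (splitAtTrue (c ∸ i) w)
  u = proj₂ (splitAtTrue (c ∸ i) w)
  w≡ : w ≡ v ++ true ∷ u
  w≡ = proj₁ split
  tv+tu≡c : trues v + trues u ≡ c
  tv+tu≡c = suc-injective (begin
    suc (trues v + trues u)    ≡⟨ +-suc (trues v) (trues u) ⟨
    trues v + trues (true ∷ u) ≡⟨ trues-++ v (true ∷ u) ⟨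
    trues (v ++ true ∷ u)      ≡⟨ cong trues w≡ ⟨
    trues w                    ≡⟨ tw≡ ⟩
    suc c                      ∎)
    where open ≡-Reasoning
  tu≡i : trues u ≡ i
  tu≡i = +-cancelˡ-≡ (c ∸ i) _ _ (begin
    c ∸ i + trues u       ≡⟨ cong (_+ trues u) (proj₂ split) ⟨
    trues v + trues u     ≡⟨ tv+tu≡c ⟩
    c                     ≡⟨ m∸n+n≡m i≤c ⟨
    c ∸ i + i             ∎)
    where open ≡-Reasoning
  g≡ : trues u + q * suc (trues v + trues u) ≡ g
  g≡ = trans (cong₂ (λ a b → a + q * suc b) tu≡i tv+tu≡c) (sym (m≡m%n+[m/n]*n g (suc c)))

insert-cut : ∀ u v q →
  insert (u ++ v) (length u + q * suc (length (u ++ v))) ≡ (v ++ true ∷ u , trues u + q * suc (trues v + trues u))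
insert-cut u v q
  rewrite [r+q*n]%n≡r (length u) q (length (u ++ v)) (length-++-≤ˡ u)
        | [r+q*n]/n≡q (length u) q (length (u ++ v)) (length-++-≤ˡ u)
        | take-length-++ u v | drop-length-++ u v | trues-++ u v | +-comm (trues u) (trues v) = refl

remove-cut : ∀ v u q →
  remove (v ++ true ∷ u) (trues u + q * suc (trues v + trues u)) ≡ (u ++ v , length u + q * suc (length (u ++ v)))
remove-cut v u q
  rewrite trues-++ v (true ∷ u) | +-suc (trues v) (trues u)
        | [r+q*n]%n≡r (trues u) q (trues v + trues u) (m≤n+m _ _)
        | [r+q*n]/n≡q (trues u) q (trues v + trues u) (m≤n+m _ _)
        | m+n∸n≡m (trues v) (trues u) | splitAtTrue-++ v u = refl

insert-elim : (P : List Bool → ℕ → List Bool × ℕ → Set) →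
  (∀ u v q → P (u ++ v) (length u + q * suc (length (u ++ v))) (v ++ true ∷ u , trues u + q * suc (trues v + trues u))) →
  ∀ w d → P w d (insert w d)
insert-elim P P-cut w d with insertView w d
... | cut u v q = subst (P _ _) (sym (insert-cut u v q)) (P-cut u v q)

remove-insert : ∀ w d → uncurry remove (insert w d) ≡ (w , d)
remove-insert = insert-elim (λ w d x → uncurry remove x ≡ (w , d)) (λ u v q → remove-cut v u q)

insert-remove : ∀ c w g → trues w ≡ suc c → uncurry insert (remove w g) ≡ (w , g)
insert-remove c w g tw≡ with removeView c w g tw≡
... | cut v u q = trans (cong (uncurry insert) (remove-cut v u q)) (insert-cut u v q)

insert-length : ∀ w d → length (proj₁ (insert w d)) ≡ suc (length w)
insert-length = insert-elim (λ w _ x → length (proj₁ x) ≡ suc (length w))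
  (λ u v _ → trans (length-++-sucʳ v true u) (cong suc (length-++-comm v u)))

insert-trues : ∀ w d → trues (proj₁ (insert w d)) ≡ suc (trues w)
insert-trues = insert-elim (λ w _ x → trues (proj₁ x) ≡ suc (trues w)) trues-cut
  where
  trues-cut : ∀ u v (q : ℕ) → trues (v ++ true ∷ u) ≡ suc (trues (u ++ v))
  trues-cut u v _ rewrite trues-++ v (true ∷ u) | trues-++ u v =
    trans (+-suc (trues v) (trues u)) (cong suc (+-comm (trues v) (trues u)))

insert-inversions : ∀ w d →
  suc (trues w) * d + inversions w ≡ inversions (proj₁ (insert w d)) + suc (length w) * proj₂ (insert w d)
insert-inversions = insert-elim
  (λ w d x → suc (trues w) * d + inversions w ≡ inversions (proj₁ x) + suc (length w) * proj₂ x) inversions-cut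
  where
  rearrange : ∀ tu fu tv fv iu iv q →
    suc (tu + tv) * (tu + fu + q * suc (tu + fu + (tv + fv))) + (iu + tu * fv + iv)
      ≡ iv + tv * fu + (fu + iu) + suc (tu + fu + (tv + fv)) * (tu + q * suc (tv + tu))
  rearrange = solve-∀
  inversions-cut : ∀ u v q →
    suc (trues (u ++ v)) * (length u + q * suc (length (u ++ v))) + inversions (u ++ v)
      ≡ inversions (v ++ true ∷ u) + suc (length (u ++ v)) * (trues u + q * suc (trues v + trues u))
  inversions-cut u v q
    rewrite length-++ u {v} | trues-++ u v | inversions-++ u v | inversions-++ v (true ∷ u)
          | length≡trues+falses u | length≡trues+falses v =
    rearrange (trues u) (falses u) (trues v) (falses v) (inversions u) (inversions v) q

remove-length : ∀ c w g → trues w ≡ suc c → length w ≡ suc (length (proj₁ (remove w g)))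
remove-length c w g tw≡ = trans (cong (λ x → length (proj₁ x)) (sym (insert-remove c w g tw≡)))
                                (insert-length (proj₁ (remove w g)) (proj₂ (remove w g)))

remove-trues : ∀ c w g → trues w ≡ suc c → trues (proj₁ (remove w g)) ≡ c
remove-trues c w g tw≡ = suc-injective (begin
  suc (trues (proj₁ (remove w g)))   ≡⟨ insert-trues (proj₁ (remove w g)) (proj₂ (remove w g)) ⟨
  trues (proj₁ (uncurry insert (remove w g)))   ≡⟨ cong (λ x → trues (proj₁ x)) (insert-remove c w g tw≡) ⟩
  trues w                            ≡⟨ tw≡ ⟩
  suc c                              ∎)
  where open ≡-Reasoning

insertAll : List Bool → List ℕ → List Bool × List ℕ
insertAll w [] = w , []
insertAll w (d ∷ ds) =
  let (w′ , g) = insert w d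
      (w″ , gs) = insertAll w′ ds
  in w″ , g ∷ gs

removeAll : List Bool → List ℕ → List Bool × List ℕ
removeAll w [] = w , []
removeAll w (g ∷ gs) =
  let (w′ , ds) = removeAll w gs
      (w″ , d) = remove w′ g
  in w″ , d ∷ ds

removeAll-insertAll : ∀ w ds → uncurry removeAll (insertAll w ds) ≡ (w , ds)
removeAll-insertAll w [] = refl
removeAll-insertAll w (d ∷ ds) =
  trans (cong (λ x → proj₁ (remove (proj₁ x) g) , proj₂ (remove (proj₁ x) g) ∷ proj₂ x)
              (removeAll-insertAll (proj₁ (insert w d)) ds))
        (cong (λ y → proj₁ y , proj₂ y ∷ ds) (remove-insert w d))
  where g = proj₂ (insert w d)

removeAll-trues : ∀ c w gs → trues w ≡ c + length gs → trues (proj₁ (removeAll w gs)) ≡ c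
removeAll-trues c w [] tw≡ = trans tw≡ (+-identityʳ c)
removeAll-trues c w (g ∷ gs) tw≡ =
  remove-trues c (proj₁ (removeAll w gs)) g (removeAll-trues (suc c) w gs (trans tw≡ (+-suc c (length gs))))

removeAll-length : ∀ c n w gs → trues w ≡ c + length gs → length w ≡ n + length gs →
  length (proj₁ (removeAll w gs)) ≡ n
removeAll-length c n w [] _ lw≡ = trans lw≡ (+-identityʳ n)
removeAll-length c n w (g ∷ gs) tw≡ lw≡ = suc-injective (trans (sym (remove-length c w′ g tw′≡))
  (removeAll-length (suc c) (suc n) w gs tw≡′ (trans lw≡ (+-suc n (length gs)))))
  where
  tw≡′ = trans tw≡ (+-suc c (length gs))
  w′ = proj₁ (removeAll w gs)
  tw′≡ = removeAll-trues (suc c) w gs tw≡′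

insertAll-removeAll : ∀ c w gs → trues w ≡ c + length gs → uncurry insertAll (removeAll w gs) ≡ (w , gs)
insertAll-removeAll c w [] _ = refl
insertAll-removeAll c w (g ∷ gs) tw≡ =
  trans (cong (λ x → proj₁ (insertAll (proj₁ x) ds) , proj₂ x ∷ proj₂ (insertAll (proj₁ x) ds))
              (insert-remove c w′ g (removeAll-trues (suc c) w gs tw≡′)))
        (cong (λ y → proj₁ y , g ∷ proj₂ y) (insertAll-removeAll (suc c) w gs tw≡′))
  where
  tw≡′ = trans tw≡ (+-suc c (length gs))
  w′ = proj₁ (removeAll w gs)
  ds = proj₂ (removeAll w gs)

insertAll-parts : ∀ w ds → length (proj₂ (insertAll w ds)) ≡ length ds
insertAll-parts w [] = refl
insertAll-parts w (d ∷ ds) = cong suc (insertAll-parts (proj₁ (insert w d)) ds)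

removeAll-parts : ∀ w gs → length (proj₂ (removeAll w gs)) ≡ length gs
removeAll-parts w [] = refl
removeAll-parts w (g ∷ gs) = cong suc (removeAll-parts w gs)

insertAll-length : ∀ w ds → length (proj₁ (insertAll w ds)) ≡ length w + length ds
insertAll-length w [] = sym (+-identityʳ (length w))
insertAll-length w (d ∷ ds) = trans (insertAll-length (proj₁ (insert w d)) ds)
  (trans (cong (_+ length ds) (insert-length w d)) (sym (+-suc (length w) (length ds))))

insertAll-trues : ∀ w ds → trues (proj₁ (insertAll w ds)) ≡ trues w + length ds
insertAll-trues w [] = sym (+-identityʳ (trues w))
insertAll-trues w (d ∷ ds) = trans (insertAll-trues (proj₁ (insert w d)) ds)
  (trans (cong (_+ length ds) (insert-trues w d)) (sym (+-suc (trues w) (length ds))))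

insertAll-inversions : ∀ w ds →
  inversions w + weightedSum (suc (trues w)) ds
    ≡ inversions (proj₁ (insertAll w ds)) + weightedSum (suc (length w)) (proj₂ (insertAll w ds))
insertAll-inversions w [] = refl
insertAll-inversions w (d ∷ ds) = begin
  inversions w + (suc (trues w) * d + X)   ≡⟨ swap (inversions w) (suc (trues w) * d) X ⟩
  suc (trues w) * d + inversions w + X     ≡⟨ cong (_+ X) (insert-inversions w d) ⟩
  inversions w′ + suc (length w) * g + X   ≡⟨ swap (suc (length w) * g) (inversions w′) X ⟨
  suc (length w) * g + (inversions w′ + X) ≡⟨ cong (suc (length w) * g +_) step ⟩
  suc (length w) * g + (inversions w″ + Y) ≡⟨ swap (suc (length w) * g) (inversions w″) Y ⟩
  inversions w″ + suc (length w) * g + Y   ≡⟨ +-assoc (inversions w″) _ Y ⟩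
  inversions w″ + (suc (length w) * g + Y) ∎
  where
  open ≡-Reasoning
  w′ = proj₁ (insert w d)
  g = proj₂ (insert w d)
  w″ = proj₁ (insertAll w′ ds)
  X = weightedSum (suc (suc (trues w))) ds
  Y = weightedSum (suc (suc (length w))) (proj₂ (insertAll w′ ds))
  swap : ∀ a b c → a + (b + c) ≡ b + a + c
  swap a b c = trans (sym (+-assoc a b c)) (cong (_+ c) (+-comm a b))
  step : inversions w′ + X ≡ inversions w″ + Y
  step = subst₂ (λ c n → inversions w′ + weightedSum (suc c) ds
                           ≡ inversions w″ + weightedSum (suc n) (proj₂ (insertAll w′ ds)))
                (insert-trues w d) (insert-length w d) (insertAll-inversions w′ ds)

-- Partitions given by their gaps

-- A partition whose consecutive parts differ by at least δ and whose parts are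
-- at least K is determined by its list of gaps; the gaps are arbitrary.
module Gaps (δ K : ℕ) where

  Spaced : List ℕ → Set
  Spaced = Linked (λ x y → δ + y ≤ x)

  -- the least part that may be put in front of xs
  bound : List ℕ → ℕ
  bound [] = K
  bound (y ∷ _) = δ + y

  fromGaps : List ℕ → List ℕ
  fromGaps [] = []
  fromGaps (g ∷ gs) = g + bound (fromGaps gs) ∷ fromGaps gs

  toGaps : List ℕ → List ℕ
  toGaps [] = []
  toGaps (x ∷ xs) = x ∸ bound xs ∷ toGaps xs

  length-fromGaps : ∀ gs → length (fromGaps gs) ≡ length gs
  length-fromGaps [] = refl
  length-fromGaps (g ∷ gs) = cong suc (length-fromGaps gs)

  length-toGaps : ∀ xs → length (toGaps xs) ≡ length xs
  length-toGaps [] = refl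
  length-toGaps (x ∷ xs) = cong suc (length-toGaps xs)

  fromGaps-spaced : ∀ gs → Spaced (fromGaps gs)
  fromGaps-spaced [] = []
  fromGaps-spaced (g ∷ []) = [-]
  fromGaps-spaced (g ∷ gs@(_ ∷ _)) = m≤n+m _ g ∷ fromGaps-spaced gs

  K≤bound : ∀ xs → All (K ≤_) xs → K ≤ bound xs
  K≤bound [] [] = ≤-refl
  K≤bound (y ∷ _) (K≤y ∷ _) = ≤-trans K≤y (m≤n+m y δ)

  fromGaps-≥ : ∀ gs → All (K ≤_) (fromGaps gs)
  fromGaps-≥ [] = []
  fromGaps-≥ (g ∷ gs) = ≤-trans (K≤bound _ (fromGaps-≥ gs)) (m≤n+m _ g) ∷ fromGaps-≥ gs

  bound≤head : ∀ x xs → Spaced (x ∷ xs) → All (K ≤_) (x ∷ xs) → bound xs ≤ x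
  bound≤head x [] _ (K≤x ∷ []) = K≤x
  bound≤head x (y ∷ _) (δ+y≤x ∷ _) _ = δ+y≤x

  toGaps-fromGaps : ∀ gs → toGaps (fromGaps gs) ≡ gs
  toGaps-fromGaps [] = refl
  toGaps-fromGaps (g ∷ gs) = cong₂ _∷_ (m+n∸n≡m g (bound (fromGaps gs))) (toGaps-fromGaps gs)

  fromGaps-toGaps : ∀ xs → Spaced xs → All (K ≤_) xs → fromGaps (toGaps xs) ≡ xs
  fromGaps-toGaps [] _ _ = refl
  fromGaps-toGaps (x ∷ xs) spaced ≥K = cong₂ _∷_
    (trans (cong (λ ys → x ∸ bound xs + bound ys) rest) (m∸n+n≡m (bound≤head x xs spaced ≥K)))
    rest
    where rest = fromGaps-toGaps xs (Linked.tail spaced) (All.tail ≥K)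

  bound-fromGaps : ∀ gs → bound (fromGaps gs) ≡ sum gs + length gs * δ + K
  bound-fromGaps [] = refl
  bound-fromGaps (g ∷ gs) rewrite bound-fromGaps gs = rearrange δ K g (sum gs) (length gs * δ)
    where
    rearrange : ∀ δ K g s l → δ + (g + (s + l + K)) ≡ g + s + (δ + l) + K
    rearrange = solve-∀

  sum-fromGaps : ∀ gs → sum (fromGaps gs) ≡ weightedSum 1 gs + triangular (length gs) * δ + length gs * K
  sum-fromGaps [] = refl
  sum-fromGaps (g ∷ gs) rewrite bound-fromGaps gs | sum-fromGaps gs | weightedSum-+ 1 1 gs =
    rearrange δ K g (sum gs) (length gs) (weightedSum 1 gs) (triangular (length gs))
    where
    rearrange : ∀ δ K g s n w t →
      g + (s + n * δ + K) + (w + t * δ + n * K) ≡ 1 * g + (w + 1 * s) + (n + t) * δ + (K + n * K)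
    rearrange = solve-∀

module Strict = Gaps 1 0

-- The record partition ν is stored as a word: a true followed by j letters
-- stands for the part k + j.
positions : ℕ → List Bool → List ℕ
positions k [] = []
positions k (true ∷ w) = k + length w ∷ positions k w
positions k (false ∷ w) = positions k w

indicator : ℕ → ℕ → List ℕ → List Bool
indicator k zero ν = []
indicator k (suc n) [] = false ∷ indicator k n []
indicator k (suc n) (v ∷ ν) with v ≟ k + n
... | yes _ = true ∷ indicator k n ν
... | no _ = false ∷ indicator k n (v ∷ ν)

length-positions : ∀ k w → length (positions k w) ≡ trues w
length-positions k [] = refl
length-positions k (true ∷ w) = cong suc (length-positions k w)
length-positions k (false ∷ w) = length-positions k w

sum-positions : ∀ k w → sum (positions k w) ≡ inversions w + triangular (trues w) + trues w * k
sum-positions k [] = refl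
sum-positions k (false ∷ w) = sum-positions k w
sum-positions k (true ∷ w) rewrite sum-positions k w | length≡trues+falses w =
  rearrange k (trues w) (falses w) (inversions w) (triangular (trues w))
  where
  rearrange : ∀ k t f i T → k + (t + f) + (i + T + t * k) ≡ f + i + (t + T) + (k + t * k)
  rearrange = solve-∀

positions-≥ : ∀ k w → All (k ≤_) (positions k w)
positions-≥ k [] = []
positions-≥ k (true ∷ w) = m≤m+n k (length w) ∷ positions-≥ k w
positions-≥ k (false ∷ w) = positions-≥ k w

positions-< : ∀ k w → All (_< k + length w) (positions k w)
positions-< k [] = []
positions-< k (true ∷ w) = k+n<k+1+n ∷ All.map (λ v< → <-trans v< k+n<k+1+n) (positions-< k w)
  where k+n<k+1+n = +-monoʳ-< k (n<1+n (length w))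
positions-< k (false ∷ w) = All.map (λ v< → <-trans v< (+-monoʳ-< k (n<1+n (length w)))) (positions-< k w)

positions-distinct : ∀ k w → Linked _>_ (positions k w)
positions-distinct k [] = []
positions-distinct k (true ∷ w) = distinct-∷ (positions-< k w) (positions-distinct k w)
positions-distinct k (false ∷ w) = positions-distinct k w

length-indicator : ∀ k n ν → length (indicator k n ν) ≡ n
length-indicator k zero ν = refl
length-indicator k (suc n) [] = cong suc (length-indicator k n [])
length-indicator k (suc n) (v ∷ ν) with v ≟ k + n
... | yes _ = cong suc (length-indicator k n ν)
... | no _ = cong suc (length-indicator k n (v ∷ ν))

indicator-below : ∀ k n ν → All (_< k + n) ν → indicator k (suc n) ν ≡ false ∷ indicator k n ν
indicator-below k n [] _ = refl
indicator-below k n (v ∷ ν) (v< ∷ _) with v ≟ k + n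
... | yes refl = ⊥-elim (n≮n v v<)
... | no _ = refl

indicator-positions : ∀ k w → indicator k (length w) (positions k w) ≡ w
indicator-positions k [] = refl
indicator-positions k (true ∷ w) with k + length w ≟ k + length w
... | yes _ = cong (true ∷_) (indicator-positions k w)
... | no k+n≢k+n = ⊥-elim (k+n≢k+n refl)
indicator-positions k (false ∷ w) =
  trans (indicator-below k (length w) (positions k w) (positions-< k w)) (cong (false ∷_) (indicator-positions k w))

positions-indicator : ∀ k n ν → Linked _>_ ν → All (k ≤_) ν → All (_< k + n) ν →
  positions k (indicator k n ν) ≡ ν
positions-indicator k zero [] _ _ _ = refl
positions-indicator k zero (v ∷ ν) _ (k≤v ∷ _) (v< ∷ _) = ⊥-elim (<⇒≱ (subst (v <_) (+-identityʳ k) v<) k≤v)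
positions-indicator k (suc n) [] _ _ _ = positions-indicator k n [] [] [] []
positions-indicator k (suc n) (v ∷ ν) distinct ≥k (v< ∷ _) with v ≟ k + n
... | yes refl = cong₂ _∷_ (cong (k +_) (length-indicator k n ν))
                           (positions-indicator k n ν (Linked.tail distinct) (All.tail ≥k) (distinct⇒<head distinct))
... | no v≢k+n = positions-indicator k n (v ∷ ν) distinct ≥k
                   (v<k+n ∷ All.map (λ u<v → <-trans u<v v<k+n) (distinct⇒<head distinct))
  where
  v<k+n : v < k + n
  v<k+n = ≤∧≢⇒< (≤-pred (subst (v <_) (+-suc k n) v<)) v≢k+n

glue : List ℕ → List ℕ → List ℕ
glue α L = map (_+ Strict.bound L) α ++ L

unglue : ℕ → List ℕ → List ℕ × List ℕ
unglue n μ = map (_∸ Strict.bound (drop n μ)) (take n μ) , drop n μ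

unglue-glue : ∀ α L → unglue (length α) (glue α L) ≡ (α , L)
unglue-glue α L = trans (cong₂ (λ x y → map (_∸ Strict.bound y) x , y) take≡ drop≡) (cong (_, L) (begin
  map (_∸ b) (map (_+ b) α) ≡⟨ map-∘ α ⟨
  map (λ a → a + b ∸ b) α   ≡⟨ map-cong (λ a → m+n∸n≡m a b) α ⟩
  map (λ a → a) α           ≡⟨ map-id α ⟩
  α                         ∎))
  where
  open ≡-Reasoning
  b = Strict.bound L
  n≡ = length-map (_+ b) α
  take≡ : take (length α) (glue α L) ≡ map (_+ b) α
  take≡ = subst (λ n → take n (glue α L) ≡ map (_+ b) α) n≡ (take-length-++ (map (_+ b) α) L)
  drop≡ : drop (length α) (glue α L) ≡ L
  drop≡ = subst (λ n → drop n (glue α L) ≡ L) n≡ (drop-length-++ (map (_+ b) α) L)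

glue-unglue : ∀ n μ → All (Strict.bound (drop n μ) ≤_) (take n μ) → uncurry glue (unglue n μ) ≡ μ
glue-unglue n μ ≥b = trans (cong (_++ drop n μ) (begin
  map (_+ b) (map (_∸ b) (take n μ)) ≡⟨ map-∘ (take n μ) ⟨
  map (λ a → a ∸ b + b) (take n μ)   ≡⟨ map-id-local (All.map m∸n+n≡m ≥b) ⟩
  take n μ                           ∎)) (take++drop≡id n μ)
  where
  open ≡-Reasoning
  b = Strict.bound (drop n μ)

length-glue : ∀ α L → length (glue α L) ≡ length α + length L
length-glue α L = trans (length-++ (map _ α)) (cong (_+ length L) (length-map _ α))

sum-glue : ∀ α L → sum (glue α L) ≡ sum α + length α * Strict.bound L + sum L
sum-glue α L = trans (sum-++ (map _ α) L) (cong (_+ sum L) (sum-map-+ (Strict.bound L) α))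

<bound : ∀ L → Linked _>_ L → All (_< Strict.bound L) L
<bound [] _ = []
<bound (y ∷ _) distinct = ≤-refl ∷ All.map m<n⇒m<1+n (distinct⇒<head distinct)

glue-distinct : ∀ α L → Linked _>_ α → Linked _>_ L → Linked _>_ (glue α L)
glue-distinct α L distinctα distinctL = go α distinctα
  where
  b = Strict.bound L
  go : ∀ α → Linked _>_ α → Linked _>_ (map (_+ b) α ++ L)
  go [] _ = distinctL
  go (a ∷ []) _ = distinct-∷ (All.map (λ y<b → ≤-trans y<b (m≤n+m b a)) (<bound L distinctL)) distinctL
  go (a ∷ α@(_ ∷ _)) (a>a′ ∷ distinct) = +-monoˡ-< b a>a′ ∷ go α distinct

glue-gap : ∀ s′ m α L → length α ≡ suc s′ → All (m ≤_) α → 0 < length L → GapAt (suc s′) m (glue α L)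
glue-gap zero m (a ∷ []) (y ∷ r) _ (m≤a ∷ []) _ =
  a + suc y , y , r , refl , subst (_≤ a + suc y) (rearrange m y) (+-monoˡ-≤ (suc y) m≤a)
  where
  rearrange : ∀ m y → m + suc y ≡ y + (m + 1)
  rearrange = solve-∀
glue-gap (suc s′) m (_ ∷ α) L length≡ (_ ∷ ≥m) 0<L = glue-gap s′ m α L (suc-injective length≡) ≥m 0<L

gap-bound : ∀ s′ m μ → Linked _>_ μ → GapAt (suc s′) m μ →
  All (λ e → m + Strict.bound (drop (suc s′) μ) ≤ e) (take (suc s′) μ)
gap-bound s′ m μ distinct (x , y , r , eq , y+m+1≤x) rewrite drop-suc s′ μ eq =
  All.map (≤-trans (subst (_≤ x) (rearrange y m) y+m+1≤x)) (take-suc-≥ s′ μ distinct eq)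
  where
  rearrange : ∀ y m → y + (m + 1) ≡ m + suc y
  rearrange = solve-∀

-- The bijection for s, t > 0

module Insertion (s′ t′ k m : ℕ) where
  s = suc s′
  t = suc t′
  K = k + s + t ∸ 1

  module Weak = Gaps 0 K

  φ : Pair → Pair
  φ (α , β) =
    let (w , gs) = insertAll (replicate s false) (Weak.toGaps β)
    in glue α (Strict.fromGaps gs) , positions k w

  ψ : Pair → Pair
  ψ (μ , ν) =
    let (α , L) = unglue s μ
        (_ , ds) = removeAll (indicator k (s + t) ν) (Strict.toGaps L)
    in α , Weak.fromGaps ds

  <⇒≤K : ∀ {v} → v < k + (s + t) → v ≤ K
  <⇒≤K {v} v< = subst (λ n → v ≤ n ∸ 1) (sym (+-assoc k s t)) (<⇒≤pred v<)

  ≤K⇒< : ∀ {v} → v ≤ K → v < k + (s + t)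
  ≤K⇒< {v} v≤ = subst (v <_) (trans (sym (+-suc (k + s) t′)) (+-assoc k s t))
                       (s≤s (subst (v ≤_) (cong pred (+-suc (k + s) t′)) v≤))

  module Forward (α β : List ℕ) (α-length : length α ≡ s) (β-length : length β ≡ t) where
    ds = Weak.toGaps β
    w = proj₁ (insertAll (replicate s false) ds)
    gs = proj₂ (insertAll (replicate s false) ds)
    L = Strict.fromGaps gs

    ds-length : length ds ≡ t
    ds-length = trans (Weak.length-toGaps β) β-length
    gs-length : length gs ≡ t
    gs-length = trans (insertAll-parts _ ds) ds-length
    L-length : length L ≡ t
    L-length = trans (Strict.length-fromGaps gs) gs-length
    w-length : length w ≡ s + t
    w-length = trans (insertAll-length _ ds) (cong₂ _+_ (length-replicate s) ds-length)
    w-trues : trues w ≡ t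
    w-trues = trans (insertAll-trues _ ds) (cong₂ _+_ (trues-replicate s) ds-length)
    unglue≡ : unglue s (glue α L) ≡ (α , L)
    unglue≡ = subst (λ n → unglue n (glue α L) ≡ (α , L)) α-length (unglue-glue α L)
    indicator≡ : indicator k (s + t) (positions k w) ≡ w
    indicator≡ = subst (λ n → indicator k n (positions k w) ≡ w) w-length (indicator-positions k w)

  φ-in : ∀ p → InA s t k m p → InB s t k m (φ p)
  φ-in (α , β) (α-distinct , α-length , α-≥m , _ , β-length , _) =
    glue-distinct α L α-distinct (Strict.fromGaps-spaced gs) ,
    trans (length-glue α L) (cong₂ _+_ α-length L-length) ,
    glue-gap s′ m α L α-length α-≥m (subst (0 <_) (sym L-length) z<s) ,
    positions-distinct k w ,
    trans (length-positions k w) w-trues ,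
    All.map (λ (k≤v , v<) → k≤v , <⇒≤K (subst (λ n → _ < k + n) w-length v<))
            (All.zip (positions-≥ k w , positions-< k w))
    where open Forward α β α-length β-length

  module Backward (μ ν : List ℕ) (μ-distinct : Linked _>_ μ) (μ-length : length μ ≡ s + t) (μ-gap : GapAt s m μ)
                  (ν-distinct : Linked _>_ ν) (ν-length : length ν ≡ t) (ν-bounds : All (λ v → k ≤ v × v ≤ K) ν) where
    L = drop s μ
    b = Strict.bound L
    gs = Strict.toGaps L
    w = indicator k (s + t) ν
    w₀ = proj₁ (removeAll w gs)
    ds = proj₂ (removeAll w gs)

    gap : All (λ e → m + b ≤ e) (take s μ)
    gap = gap-bound s′ m μ μ-distinct μ-gap
    take-≥b : All (b ≤_) (take s μ)
    take-≥b = All.map (≤-trans (m≤n+m b m)) gap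
    take-length : length (take s μ) ≡ s
    take-length = trans (length-take s μ) (trans (cong (s ⊓_) μ-length) (m≤n⇒m⊓n≡m (m≤m+n s t)))
    gs-length : length gs ≡ t
    gs-length = trans (Strict.length-toGaps L) (trans (length-drop s μ) (trans (cong (_∸ s) μ-length) (m+n∸m≡n s t)))
    positions-w : positions k w ≡ ν
    positions-w = positions-indicator k (s + t) ν ν-distinct
                    (All.map proj₁ ν-bounds) (All.map (λ (_ , v≤) → ≤K⇒< v≤) ν-bounds)
    w-trues : trues w ≡ 0 + length gs
    w-trues = trans (sym (length-positions k w)) (trans (cong length positions-w) (trans ν-length (sym gs-length)))
    w-length : length w ≡ s + length gs
    w-length = trans (length-indicator k (s + t) ν) (cong (s +_) (sym gs-length))
    ds-length : length ds ≡ t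
    ds-length = trans (removeAll-parts w gs) gs-length
    w₀≡ : w₀ ≡ replicate s false
    w₀≡ = trans (trues≡0⇒replicate w₀ (removeAll-trues 0 w gs w-trues))
                (cong (λ n → replicate n false) (removeAll-length 0 s w gs w-trues w-length))
    insertAll≡ : insertAll (replicate s false) (Weak.toGaps (Weak.fromGaps ds)) ≡ (w , gs)
    insertAll≡ = trans (cong₂ insertAll (sym w₀≡) (Weak.toGaps-fromGaps ds)) (insertAll-removeAll 0 w gs w-trues)
    fromGaps≡ : Strict.fromGaps gs ≡ L
    fromGaps≡ = Strict.fromGaps-toGaps L (linked-drop s μ-distinct) (All.universal (λ _ → z≤n) L)

  ψ-in : ∀ q → InB s t k m q → InA s t k m (ψ q)
  ψ-in (μ , ν) (μ-distinct , μ-length , μ-gap , ν-distinct , ν-length , ν-bounds) =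
    map-∸-distinct b (linked-take s μ-distinct) take-≥b ,
    trans (length-map _ (take s μ)) take-length ,
    map⁺ (All.map (m+n≤o⇒m≤o∸n m) gap) ,
    Weak.fromGaps-spaced ds ,
    trans (Weak.length-fromGaps ds) ds-length ,
    Weak.fromGaps-≥ ds
    where open Backward μ ν μ-distinct μ-length μ-gap ν-distinct ν-length ν-bounds

  ψφ : ∀ p → InA s t k m p → ψ (φ p) ≡ p
  ψφ (α , β) (_ , α-length , _ , β-partition , β-length , β-≥K) = begin
    ψ (φ (α , β))
      ≡⟨ cong₂ (λ u v → proj₁ u , Weak.fromGaps (proj₂ (removeAll v (Strict.toGaps (proj₂ u))))) unglue≡ indicator≡ ⟩
    α , Weak.fromGaps (proj₂ (removeAll w (Strict.toGaps L)))
      ≡⟨ cong (λ x → α , Weak.fromGaps (proj₂ (removeAll w x))) (Strict.toGaps-fromGaps gs) ⟩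
    α , Weak.fromGaps (proj₂ (uncurry removeAll (insertAll (replicate s false) ds)))
      ≡⟨ cong (λ x → α , Weak.fromGaps (proj₂ x)) (removeAll-insertAll _ ds) ⟩
    α , Weak.fromGaps ds
      ≡⟨ cong (α ,_) (Weak.fromGaps-toGaps β β-partition β-≥K) ⟩
    α , β ∎
    where
    open ≡-Reasoning
    open Forward α β α-length β-length

  φψ : ∀ q → InB s t k m q → φ (ψ q) ≡ q
  φψ (μ , ν) (μ-distinct , μ-length , μ-gap , ν-distinct , ν-length , ν-bounds) = begin
    φ (ψ (μ , ν))
      ≡⟨ cong (λ x → glue α (Strict.fromGaps (proj₂ x)) , positions k (proj₁ x)) insertAll≡ ⟩
    glue α (Strict.fromGaps gs) , positions k w
      ≡⟨ cong₂ (λ x y → glue α x , y) fromGaps≡ positions-w ⟩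
    glue α L , ν
      ≡⟨ cong (_, ν) (glue-unglue s μ take-≥b) ⟩
    μ , ν ∎
    where
    open ≡-Reasoning
    open Backward μ ν μ-distinct μ-length μ-gap ν-distinct ν-length ν-bounds
    α = proj₁ (unglue s μ)

  φ-size : ∀ p → InA s t k m p → size p ≡ size (φ p)
  φ-size (α , β) (_ , α-length , _ , β-partition , β-length , β-≥K) = begin
    sum α + sum β
      ≡⟨ cong (sum α +_) sum-β ⟩
    sum α + (I + (W + s * G) + T * 0 + (t * k + t * s + 2 * T))
      ≡⟨ rearrange (sum α) s t k I W G T ⟩
    sum α + s * (G + t * 1 + 0) + (W + T * 1 + t * 0) + (I + T + t * k)
      ≡⟨ cong₂ _+_ sum-μ sum-ν ⟨
    sum (glue α L) + sum (positions k w) ∎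
    where
    open ≡-Reasoning
    open Forward α β α-length β-length
    I = inversions w
    W = weightedSum 1 gs
    G = sum gs
    T = triangular t
    rearrange : ∀ a s t k I W G T →
      a + (I + (W + s * G) + T * 0 + (t * k + t * s + 2 * T)) ≡ a + s * (G + t * 1 + 0) + (W + T * 1 + t * 0) + (I + T + t * k)
    rearrange = solve-∀
    weightedSum-ds : weightedSum 1 ds ≡ I + (W + s * G)
    weightedSum-ds = begin
      weightedSum 1 ds
        ≡⟨ cong₂ (λ i c → i + weightedSum (suc c) ds) (inversions-replicate s) (trues-replicate s) ⟨
      inversions (replicate s false) + weightedSum (suc (trues (replicate s false))) ds
        ≡⟨ insertAll-inversions _ ds ⟩
      I + weightedSum (suc (length (replicate s false))) gs
        ≡⟨ cong (λ n → I + weightedSum (suc n) gs) (length-replicate s) ⟩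
      I + weightedSum (1 + s) gs
        ≡⟨ cong (I +_) (weightedSum-+ 1 s gs) ⟩
      I + (W + s * G) ∎
    sum-β : sum β ≡ I + (W + s * G) + T * 0 + (t * k + t * s + 2 * T)
    sum-β = begin
      sum β
        ≡⟨ cong sum (Weak.fromGaps-toGaps β β-partition β-≥K) ⟨
      sum (Weak.fromGaps ds)
        ≡⟨ Weak.sum-fromGaps ds ⟩
      weightedSum 1 ds + triangular (length ds) * 0 + length ds * K
        ≡⟨ cong (λ n → weightedSum 1 ds + triangular n * 0 + n * K) ds-length ⟩
      weightedSum 1 ds + T * 0 + t * K
        ≡⟨ cong₂ (λ x y → x + T * 0 + y) weightedSum-ds (t*[k+s+t∸1]≡t*k+t*s+2T k s t) ⟩
      I + (W + s * G) + T * 0 + (t * k + t * s + 2 * T) ∎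
    sum-μ : sum (glue α L) ≡ sum α + s * (G + t * 1 + 0) + (W + T * 1 + t * 0)
    sum-μ = trans (sum-glue α L) (cong₂ (λ x y → sum α + x + y)
      (cong₂ _*_ α-length (trans (Strict.bound-fromGaps gs) (cong (λ n → G + n * 1 + 0) gs-length)))
      (trans (Strict.sum-fromGaps gs) (cong (λ n → W + triangular n * 1 + n * 0) gs-length)))
    sum-ν : sum (positions k w) ≡ I + T + t * k
    sum-ν = trans (sum-positions k w) (cong (λ n → I + triangular n + n * k) w-trues)

-- The bijection for s = 0 < t

shiftDownFrom≡fromGaps : ∀ k K i β → k + i + length β ≡ suc K → Partition β → All (K ≤_) β →
  shiftDownFrom k i β ≡ Strict.fromGaps (Gaps.toGaps 0 K β)
shiftDownFrom≡fromGaps k K i [] _ _ _ = refl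
shiftDownFrom≡fromGaps k K i (b ∷ β) length≡ partition (_ ∷ β-≥K) =
  cong₂ _∷_ (trans (head-≡ β partition β-≥K length≡) (cong (λ x → b ∸ Gaps.bound 0 K β + Strict.bound x) rest))
            rest
  where
  length≡′ : k + suc i + length β ≡ suc K
  length≡′ = trans (cong (_+ length β) (+-suc k i)) (trans (sym (+-suc (k + i) (length β))) length≡)
  rest = shiftDownFrom≡fromGaps k K (suc i) β length≡′ (Linked.tail partition) β-≥K
  head-≡ : ∀ β → Partition (b ∷ β) → All (K ≤_) β → k + i + suc (length β) ≡ suc K →
    b ∸ (k + i) ≡ b ∸ Gaps.bound 0 K β + Strict.bound (shiftDownFrom k (suc i) β)
  head-≡ [] _ _ length≡ = trans (cong (b ∸_) k+i≡K) (sym (+-identityʳ (b ∸ K)))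
    where
    k+i≡K : k + i ≡ K
    k+i≡K = trans (sym (+-identityʳ (k + i))) (suc-injective (trans (sym (+-suc (k + i) 0)) length≡))
  head-≡ (c ∷ β) (c≤b ∷ _) (K≤c ∷ _) length≡ = begin
    b ∸ (k + i)                    ≡⟨ m∸n+n∸o≡m∸o (<⇒≤ k+i<c) c≤b ⟨
    b ∸ c + (c ∸ (k + i))          ≡⟨ cong (b ∸ c +_) (+-∸-assoc 1 k+i<c) ⟩
    b ∸ c + suc (c ∸ suc (k + i))  ≡⟨ cong (λ j → b ∸ c + suc (c ∸ j)) (+-suc k i) ⟨
    b ∸ c + suc (c ∸ (k + suc i))  ∎
    where
    open ≡-Reasoning
    k+i<K : k + i < K
    k+i<K = subst (k + i <_) (suc-injective (trans (sym (+-suc (k + i) (suc (length β)))) length≡))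
                  (m<m+n (k + i) z<s)
    k+i<c : k + i < c
    k+i<c = <-≤-trans k+i<K K≤c

sum-stair : ∀ k t → sum (stair k t) ≡ triangular t + t * k
sum-stair k zero = refl
sum-stair k (suc t) rewrite sum-stair k t = rearrange k t (triangular t)
  where
  rearrange : ∀ k t T → k + t + (T + t * k) ≡ t + T + (k + t * k)
  rearrange = solve-∀

module Shift (t′ k m : ℕ) where
  t = suc t′
  K = k + 0 + t ∸ 1

  module Weak = Gaps 0 K

  φ : Pair → Pair
  φ (_ , β) = shiftDown k β , stair k t

  ψ : Pair → Pair
  ψ (μ , _) = [] , Weak.fromGaps (Strict.toGaps μ)

  shiftDown≡ : ∀ β → length β ≡ t → Partition β → All (K ≤_) β →
    shiftDown k β ≡ Strict.fromGaps (Weak.toGaps β)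
  shiftDown≡ β β-length = shiftDownFrom≡fromGaps k K 0 β (trans (cong (k + 0 +_) β-length) k+t≡1+K)
    where
    k+t≡1+K : k + 0 + suc t′ ≡ suc K
    k+t≡1+K = trans (+-suc (k + 0) t′) (cong (λ n → suc (pred n)) (sym (+-suc (k + 0) t′)))

  φ-in : ∀ p → InA 0 t k m p → InB 0 t k m (φ p)
  φ-in (α , β) (_ , _ , _ , β-partition , β-length , β-≥K) =
    subst DistinctPartition (sym shiftDown-β) (Strict.fromGaps-spaced (Weak.toGaps β)) ,
    trans (cong length shiftDown-β)
          (trans (Strict.length-fromGaps (Weak.toGaps β)) (trans (Weak.length-toGaps β) β-length)) ,
    refl
    where shiftDown-β = shiftDown≡ β β-length β-partition β-≥K

  ψ-in : ∀ q → InB 0 t k m q → InA 0 t k m (ψ q)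
  ψ-in (μ , ν) (_ , μ-length , _) =
    [] , refl , [] , Weak.fromGaps-spaced gs , trans (Weak.length-fromGaps gs) (trans (Strict.length-toGaps μ) μ-length) ,
    Weak.fromGaps-≥ gs
    where gs = Strict.toGaps μ

  ψφ : ∀ p → InA 0 t k m p → ψ (φ p) ≡ p
  ψφ ([] , β) (_ , _ , _ , β-partition , β-length , β-≥K) = cong ([] ,_) (begin
    Weak.fromGaps (Strict.toGaps (shiftDown k β))
      ≡⟨ cong (λ x → Weak.fromGaps (Strict.toGaps x)) (shiftDown≡ β β-length β-partition β-≥K) ⟩
    Weak.fromGaps (Strict.toGaps (Strict.fromGaps (Weak.toGaps β)))
      ≡⟨ cong Weak.fromGaps (Strict.toGaps-fromGaps (Weak.toGaps β)) ⟩
    Weak.fromGaps (Weak.toGaps β)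
      ≡⟨ Weak.fromGaps-toGaps β β-partition β-≥K ⟩
    β ∎)
    where open ≡-Reasoning

  φψ : ∀ q → InB 0 t k m q → φ (ψ q) ≡ q
  φψ (μ , ν) (μ-distinct , μ-length , refl) = cong (_, stair k t) (begin
    shiftDown k (Weak.fromGaps gs)
      ≡⟨ shiftDown≡ (Weak.fromGaps gs) (trans (Weak.length-fromGaps gs) (trans (Strict.length-toGaps μ) μ-length))
                    (Weak.fromGaps-spaced gs) (Weak.fromGaps-≥ gs) ⟩
    Strict.fromGaps (Weak.toGaps (Weak.fromGaps gs))
      ≡⟨ cong Strict.fromGaps (Weak.toGaps-fromGaps gs) ⟩
    Strict.fromGaps gs
      ≡⟨ Strict.fromGaps-toGaps μ μ-distinct (All.universal (λ _ → z≤n) μ) ⟩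
    μ ∎)
    where
    open ≡-Reasoning
    gs = Strict.toGaps μ

  φ-size : ∀ p → InA 0 t k m p → size p ≡ size (φ p)
  φ-size ([] , β) (_ , _ , _ , β-partition , β-length , β-≥K) = begin
    sum β
      ≡⟨ cong sum (Weak.fromGaps-toGaps β β-partition β-≥K) ⟨
    sum (Weak.fromGaps ds)
      ≡⟨ Weak.sum-fromGaps ds ⟩
    W + triangular (length ds) * 0 + length ds * K
      ≡⟨ cong (λ n → W + triangular n * 0 + n * K) ds-length ⟩
    W + T * 0 + t * K
      ≡⟨ cong (W + T * 0 +_) (t*[k+s+t∸1]≡t*k+t*s+2T k 0 t) ⟩
    W + T * 0 + (t * k + t * 0 + 2 * T)
      ≡⟨ rearrange W T t k ⟩
    W + T * 1 + t * 0 + (T + t * k)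
      ≡⟨ cong₂ _+_ sum-μ (sum-stair k t) ⟨
    sum (shiftDown k β) + sum (stair k t) ∎
    where
    open ≡-Reasoning
    ds = Weak.toGaps β
    W = weightedSum 1 ds
    T = triangular t
    ds-length : length ds ≡ t
    ds-length = trans (Weak.length-toGaps β) β-length
    rearrange : ∀ W T t k → W + T * 0 + (t * k + t * 0 + 2 * T) ≡ W + T * 1 + t * 0 + (T + t * k)
    rearrange = solve-∀
    sum-μ : sum (shiftDown k β) ≡ W + T * 1 + t * 0
    sum-μ = trans (cong sum (shiftDown≡ β β-length β-partition β-≥K))
                  (trans (Strict.sum-fromGaps ds) (cong (λ n → W + triangular n * 1 + n * 0) ds-length))

theorem3p1 : (s t k m : ℕ) →
    Σ (Pair → Pair) λ φ → Σ (Pair → Pair) λ ψ →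
    (∀ p → InA s t k m p → InB s t k m (φ p)) ×
    (∀ q → InB s t k m q → InA s t k m (ψ q)) ×
    (∀ p → InA s t k m p → ψ (φ p) ≡ p) ×
    (∀ q → InB s t k m q → φ (ψ q) ≡ q) ×
    (∀ p → InA s t k m p → Prescribed s t k p (φ p)) ×
    (∀ p → InA s t k m p → size p ≡ size (φ p))
theorem3p1 zero zero k m =
  (λ _ → [] , []) , (λ _ → [] , []) ,
  (λ _ _ → refl , refl) ,
  (λ _ _ → [] , refl , [] , [] , refl , []) ,
  (λ { ([] , []) _ → refl }) ,
  (λ { (μ , ν) (refl , refl) → refl }) ,
  (λ _ _ → refl , refl) ,
  (λ { ([] , []) _ → refl })
theorem3p1 (suc s′) zero k m =
  (λ (α , _) → α , []) , (λ (μ , _) → μ , []) ,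
  (λ { (α , β) (α-distinct , α-length , α-≥m , _) → α-distinct , α-length , α-≥m , refl }) ,
  (λ { (μ , ν) (μ-distinct , μ-length , μ-≥m , _) → μ-distinct , μ-length , μ-≥m , [] , refl , [] }) ,
  (λ { (α , []) _ → refl }) ,
  (λ { (μ , ν) (_ , _ , _ , refl) → refl }) ,
  (λ _ _ → refl , refl) ,
  (λ { (α , []) _ → refl })
theorem3p1 zero (suc t′) k m = φ , ψ , φ-in , ψ-in , ψφ , φψ , (λ _ _ → refl , refl) , φ-size
  where open Shift t′ k m
theorem3p1 (suc s′) (suc t′) k m = φ , ψ , φ-in , ψ-in , ψφ , φψ , (λ _ _ → tt) , φ-size
  where open Insertion s′ t′ k m
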